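{- For a formula $\phi$, a variable $x$ and a variable $a$, the formula $a\in\{x\mid\phi\}\Rightarrow\exists x\,\phi$ is derivable.
   Context: Formal system. Objects are generated from the constant $\varnothing$ by: $(\alpha)^{\mathsf c}$, $(\alpha)^{\mathsf v}$ (variables are objects of this form), $(\alpha\,\&\,\beta)$ (federation), $(\alpha\Rightarrow\beta)$ (containment/implication), $(\alpha\cap\beta)$, and classes $\{x\mid\beta\}$ ($x$ a variable, which becomes a bound index). $\alpha[x:=\beta]$ replaces every free appearance of $x$ by $\beta$. A formula is an object of the form $\alpha\Rightarrow\beta$. Abbreviations: $\bot:=\varnothing^{\mathsf c}$; $\neg a:=(a\Rightarrow\bot)$; $\bar a:=(\varnothing\Rightarrow a)$; $a\vee b:=\overline{\bar a\cap\bar b}$; $a=b:=(a\Rightarrow b)\&(b\Rightarrow a)$; $a\neq b:=\neg(a=b)$; $\mathrm{Sing}(a):=(\bar a\neq a)\,\&\,((a\Rightarrow b)\Rightarrow(\bar b\vee a=b))$, with $b$ a variable; $a\in b:=\mathrm{Sing}(a)\&(b\Rightarrow a)$; $V:=\{x\mid\varnothing\}$; $\forall x\,\phi:=(V=\{x\mid\phi\})$; $\exists x\,\phi:=(\varnothing\neq\{x\mid\phi\})$. Rules: R1 from $\alpha$ and $\alpha\Rightarrow\beta$ infer $\beta$; R2 from $\alpha$ infer $\alpha[x:=\beta]$; R3 if $x$ does not appear in $\gamma$, from $\gamma\Rightarrow(\alpha\Rightarrow\beta)$ infer $\gamma\Rightarrow(\{x\mid\beta\}\Rightarrow\{x\mid\alpha\})$.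 Axioms ($a,b,c,d,x$ variables): A1 $((c\Rightarrow a)\&(c\Rightarrow(a\Rightarrow b)))\Rightarrow(c\Rightarrow b)$; A2 $((d\Rightarrow(a\Rightarrow b))\&(d\Rightarrow(b\Rightarrow c)))\Rightarrow(d\Rightarrow(a\Rightarrow c))$; A3 $((c\Rightarrow a)\&(c\Rightarrow b))\Rightarrow(c\Rightarrow(a\&b))$; A4 $(a\&b)\Rightarrow a$, $(a\&b)\Rightarrow b$; A5 $a\Rightarrow(a\cap b)$, $b\Rightarrow(a\cap b)$; A6 $((a\Rightarrow c)\&(b\Rightarrow c))\Rightarrow((a\cap b)\Rightarrow c)$; A7 $a\Rightarrow a$; A8 $a\Rightarrow\varnothing$; A9 $\bot\Rightarrow a$; A10 $(\varnothing\Rightarrow a)\Rightarrow((\varnothing\Rightarrow b)\Rightarrow(a\&b))$; A11 $(a\Rightarrow b)\Rightarrow(\varnothing\Rightarrow(a\Rightarrow b))$; A12 $(((a\Rightarrow b)\Rightarrow\bot)\Rightarrow\bot)\Rightarrow(a\Rightarrow b)$; A13 (schema) $a\in\{x\mid\alpha\}=(\mathrm{Sing}(a)\&\alpha[x:=a])$; A14a $a\Rightarrow\{x\mid x\in a\}$; A14b $(V\Rightarrow a)\Rightarrow(\{x\mid x\in a\}\Rightarrow a)$. -}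

module Defs where

open import Data.Bool using (Bool; true; false; _∧_; _∨_; if_then_else_)
open import Relation.Binary.PropositionalEquality using (_≡_)

-- Objects.  The variable (α)ᵛ is written  α ᵛ ; a class {x | β} with
-- x = ξ ᵛ is written  cls ξ β  (the binder is always a variable).

infix 30 _ᶜ _ᵛ

data Obj : Set where
  ∅   : Obj
  _ᶜ  : Obj → Obj
  _ᵛ  : Obj → Obj
  _&_ : Obj → Obj → Obj
  _⇒_ : Obj → Obj → Obj
  _∩_ : Obj → Obj → Obj
  cls : Obj → Obj → Obj

eqObj : Obj → Obj → Bool
eqObj ∅ ∅ = true
eqObj (a ᶜ) (b ᶜ) = eqObj a b
eqObj (a ᵛ) (b ᵛ) = eqObj a b
eqObj (a & b) (c & d) = eqObj a c ∧ eqObj b d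
eqObj (a ⇒ b) (c ⇒ d) = eqObj a c ∧ eqObj b d
eqObj (a ∩ b) (c ∩ d) = eqObj a c ∧ eqObj b d
eqObj (cls a b) (cls c d) = eqObj a c ∧ eqObj b d
eqObj _ _ = false

-- Substitution  t [ ξ ᵛ := β ]  (written  sub ξ β t ): replaces every
-- free appearance of the variable ξ ᵛ by β.  Variables are atomic.

sub : Obj → Obj → Obj → Obj
sub ξ β ∅ = ∅
sub ξ β (t ᶜ) = (sub ξ β t) ᶜ
sub ξ β (η ᵛ) = if eqObj η ξ then β else η ᵛ
sub ξ β (s & t) = sub ξ β s & sub ξ β t
sub ξ β (s ⇒ t) = sub ξ β s ⇒ sub ξ β t
sub ξ β (s ∩ t) = sub ξ β s ∩ sub ξ β t
sub ξ β (cls η t) = if eqObj η ξ then cls η t else cls η (sub ξ β t)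

appears : Obj → Obj → Bool
appears ξ ∅ = false
appears ξ (t ᶜ) = appears ξ t
appears ξ (η ᵛ) = eqObj η ξ
appears ξ (s & t) = appears ξ s ∨ appears ξ t
appears ξ (s ⇒ t) = appears ξ s ∨ appears ξ t
appears ξ (s ∩ t) = appears ξ s ∨ appears ξ t
appears ξ (cls η t) = eqObj η ξ ∨ appears ξ t

data IsFormula : Obj → Set where
  formula : (α β : Obj) → IsFormula (α ⇒ β)

⊥ₒ : Obj
⊥ₒ = ∅ ᶜ

¬ₒ : Obj → Obj
¬ₒ a = a ⇒ ⊥ₒ

bar : Obj → Obj
bar a = ∅ ⇒ a

_∨ₒ_ : Obj → Obj → Obj
a ∨ₒ b = bar (bar a ∩ bar b)

_≐_ : Obj → Obj → Obj
a ≐ b = (a ⇒ b) & (b ⇒ a)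

_≠ₒ_ : Obj → Obj → Obj
a ≠ₒ b = ¬ₒ (a ≐ b)

-- the fixed variable b used in the definition of Sing
bSing : Obj
bSing = (∅ ᶜ) ᵛ

Sing : Obj → Obj
Sing a = (bar a ≠ₒ a) & ((a ⇒ bSing) ⇒ (bar bSing ∨ₒ (a ≐ bSing)))

_∈ₒ_ : Obj → Obj → Obj
a ∈ₒ b = Sing a & (b ⇒ a)

-- V := { x ∣ ∅ } with the fixed variable x = ∅ ᵛ
Vₒ : Obj
Vₒ = cls ∅ ∅

All : Obj → Obj → Obj
All ξ φ = Vₒ ≐ cls ξ φ

Ex : Obj → Obj → Obj
Ex ξ φ = ∅ ≠ₒ cls ξ φ

-- Derivability.  Axiom letters a,b,c,d,x range over all variables.

data ⊢_ : Obj → Set where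
  R1 : ∀ {α β} → ⊢ α → ⊢ (α ⇒ β) → ⊢ β
  R2 : ∀ {α} (ξ β : Obj) → ⊢ α → ⊢ sub ξ β α
  R3 : ∀ {γ α β} (ξ : Obj) → appears ξ γ ≡ false →
       ⊢ (γ ⇒ (α ⇒ β)) → ⊢ (γ ⇒ (cls ξ β ⇒ cls ξ α))
  A1 : ∀ a' b' c' → let a = a' ᵛ ; b = b' ᵛ ; c = c' ᵛ in
       ⊢ (((c ⇒ a) & (c ⇒ (a ⇒ b))) ⇒ (c ⇒ b))
  A2 : ∀ a' b' c' d' → let a = a' ᵛ ; b = b' ᵛ ; c = c' ᵛ ; d = d' ᵛ in
       ⊢ (((d ⇒ (a ⇒ b)) & (d ⇒ (b ⇒ c))) ⇒ (d ⇒ (a ⇒ c)))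
  A3 : ∀ a' b' c' → let a = a' ᵛ ; b = b' ᵛ ; c = c' ᵛ in
       ⊢ (((c ⇒ a) & (c ⇒ b)) ⇒ (c ⇒ (a & b)))
  A4l : ∀ a' b' → let a = a' ᵛ ; b = b' ᵛ in ⊢ ((a & b) ⇒ a)
  A4r : ∀ a' b' → let a = a' ᵛ ; b = b' ᵛ in ⊢ ((a & b) ⇒ b)
  A5l : ∀ a' b' → let a = a' ᵛ ; b = b' ᵛ in ⊢ (a ⇒ (a ∩ b))
  A5r : ∀ a' b' → let a = a' ᵛ ; b = b' ᵛ in ⊢ (b ⇒ (a ∩ b))
  A6 : ∀ a' b' c' → let a = a' ᵛ ; b = b' ᵛ ; c = c' ᵛ in
       ⊢ (((a ⇒ c) & (b ⇒ c)) ⇒ ((a ∩ b) ⇒ c))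
  A7 : ∀ a' → let a = a' ᵛ in ⊢ (a ⇒ a)
  A8 : ∀ a' → let a = a' ᵛ in ⊢ (a ⇒ ∅)
  A9 : ∀ a' → let a = a' ᵛ in ⊢ (⊥ₒ ⇒ a)
  A10 : ∀ a' b' → let a = a' ᵛ ; b = b' ᵛ in
        ⊢ ((∅ ⇒ a) ⇒ ((∅ ⇒ b) ⇒ (a & b)))
  A11 : ∀ a' b' → let a = a' ᵛ ; b = b' ᵛ in
        ⊢ ((a ⇒ b) ⇒ (∅ ⇒ (a ⇒ b)))
  A12 : ∀ a' b' → let a = a' ᵛ ; b = b' ᵛ in
        ⊢ ((((a ⇒ b) ⇒ ⊥ₒ) ⇒ ⊥ₒ) ⇒ (a ⇒ b))
  A13 : ∀ a' ξ α → let a = a' ᵛ in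
        ⊢ ((a ∈ₒ cls ξ α) ≐ (Sing a & sub ξ a α))
  A14a : ∀ a' ξ → let a = a' ᵛ ; x = ξ ᵛ in
         ⊢ (a ⇒ cls ξ (x ∈ₒ a))
  A14b : ∀ a' ξ → let a = a' ᵛ ; x = ξ ᵛ in
         ⊢ ((Vₒ ⇒ a) ⇒ (cls ξ (x ∈ₒ a) ⇒ a))

module Submission where

-- Write  A = a ᵛ,  C = {x ∣ φ}  and  Q = (∅ ≐ C).  Since
-- Ex ξ φ  is  Q ⇒ ⊥, it suffices (by currying) to derive
-- (A ∈ C) & Q ⇒ ⊥.  Under that hypothesis  ∅ ⇒ C  and  C ⇒ A  give
-- ∅ ⇒ A, i.e. bar A; together with the axiom  A ⇒ ∅  this yields
-- A ⇒ bar A, while  bar A ⇒ A  always holds; so  bar A ≐ A, contradicting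
-- the first clause  bar A ≠ A  of  Sing A.  Nothing about φ is used:
-- no object is a member of an object equal to ∅.

open import Defs
open import Data.Bool using (Bool; true; false; _∧_)
open import Data.Nat using (ℕ; suc; _+_; _≤_)
open import Data.Nat.Properties using (≤-refl; ≤-trans; <⇒≤; <-irrefl; m≤m+n; m≤n+m)
open import Data.Product using (_×_; _,_)
open import Data.Empty using (⊥-elim)
open import Relation.Binary.PropositionalEquality
  using (_≡_; refl; sym; cong; cong₂; subst)

-- Number of constructors of an object; used to choose fresh variables.
size : Obj → ℕ
size ∅ = 0
size (t ᶜ) = suc (size t)
size (t ᵛ) = suc (size t)
size (s & t) = suc (size s + size t)
size (s ⇒ t) = suc (size s + size t)
size (s ∩ t) = suc (size s + size t)
size (cls s t) = suc (size s + size t)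

left≤ : ∀ {a b c} → suc (a + b) ≤ c → a ≤ c
left≤ {a} {b} p = ≤-trans (m≤m+n a b) (<⇒≤ p)

right≤ : ∀ {a b c} → suc (a + b) ≤ c → b ≤ c
right≤ {a} {b} p = ≤-trans (m≤n+m b a) (<⇒≤ p)

∧-true : ∀ {x y} → x ∧ y ≡ true → x ≡ true × y ≡ true
∧-true {true} {true} refl = refl , refl

eqObj-sound : ∀ m n → eqObj m n ≡ true → m ≡ n
eqObj-sound ∅ ∅ e = refl
eqObj-sound (a ᶜ) (b ᶜ) e = cong _ᶜ (eqObj-sound a b e)
eqObj-sound (a ᵛ) (b ᵛ) e = cong _ᵛ (eqObj-sound a b e)
eqObj-sound (a & b) (c & d) e with ∧-true {eqObj a c} e
... | e₁ , e₂ = cong₂ _&_ (eqObj-sound a c e₁) (eqObj-sound b d e₂)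
eqObj-sound (a ⇒ b) (c ⇒ d) e with ∧-true {eqObj a c} e
... | e₁ , e₂ = cong₂ _⇒_ (eqObj-sound a c e₁) (eqObj-sound b d e₂)
eqObj-sound (a ∩ b) (c ∩ d) e with ∧-true {eqObj a c} e
... | e₁ , e₂ = cong₂ _∩_ (eqObj-sound a c e₁) (eqObj-sound b d e₂)
eqObj-sound (cls a b) (cls c d) e with ∧-true {eqObj a c} e
... | e₁ , e₂ = cong₂ cls (eqObj-sound a c e₁) (eqObj-sound b d e₂)

eqObj-refl : ∀ n → eqObj n n ≡ true
eqObj-refl ∅ = refl
eqObj-refl (n ᶜ) = eqObj-refl n
eqObj-refl (n ᵛ) = eqObj-refl n
eqObj-refl (a & b) rewrite eqObj-refl a | eqObj-refl b = refl
eqObj-refl (a ⇒ b) rewrite eqObj-refl a | eqObj-refl b = refl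
eqObj-refl (a ∩ b) rewrite eqObj-refl a | eqObj-refl b = refl
eqObj-refl (cls a b) rewrite eqObj-refl a | eqObj-refl b = refl

-- If t is no larger than n, the variable n ᵛ (of size 1 + size n) cannot
-- occur in t, so substituting for it does nothing.
sub-fresh : ∀ n Z t → size t ≤ size n → sub n Z t ≡ t
sub-fresh n Z ∅ p = refl
sub-fresh n Z (t ᶜ) p = cong _ᶜ (sub-fresh n Z t (<⇒≤ p))
sub-fresh n Z (μ ᵛ) p with eqObj μ n in μ≟n
... | true = ⊥-elim (<-irrefl refl (subst (λ k → suc (size μ) ≤ size k) (sym (eqObj-sound μ n μ≟n)) p))
... | false = refl
sub-fresh n Z (s & t) p = cong₂ _&_ (sub-fresh n Z s (left≤ p)) (sub-fresh n Z t (right≤ p))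
sub-fresh n Z (s ⇒ t) p = cong₂ _⇒_ (sub-fresh n Z s (left≤ p)) (sub-fresh n Z t (right≤ p))
sub-fresh n Z (s ∩ t) p = cong₂ _∩_ (sub-fresh n Z s (left≤ p)) (sub-fresh n Z t (right≤ p))
sub-fresh n Z (cls μ s) p with eqObj μ n
... | true = refl
... | false = cong (cls μ) (sub-fresh n Z s (right≤ p))

size-left : ∀ {a b} → a ≤ suc (a + b)
size-left = left≤ ≤-refl

size-right : ∀ {a b} → b ≤ suc (a + b)
size-right = right≤ ≤-refl

-- An axiom stated for variables is instantiated by substituting for its
-- variables one after the other (rule R2).  The variables are named
-- ∅, X & ∅, C ⇒ X, ... so that each is strictly larger than every value
-- substituted before it; by sub-fresh the later substitutions then leave
-- the earlier values untouched.

ax7 : ∀ X → ⊢ (X ⇒ X)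
ax7 X = R2 ∅ X (A7 ∅)

ax8 : ∀ X → ⊢ (X ⇒ ∅)
ax8 X = R2 ∅ X (A8 ∅)

module _ (X Y : Obj) where
  private
    y = X & ∅
    X′ = ∅ ᵛ
    Y′ = y ᵛ

  ax4l : ⊢ ((X & Y) ⇒ X)
  ax4l = subst ⊢_ instance≡ (R2 y Y (R2 ∅ X (A4l ∅ y)))
    where
    instance≡ : sub y Y (sub ∅ X ((X′ & Y′) ⇒ X′)) ≡ ((X & Y) ⇒ X)
    instance≡ rewrite eqObj-refl X | sub-fresh y Y X size-left = refl

  ax4r : ⊢ ((X & Y) ⇒ Y)
  ax4r = subst ⊢_ instance≡ (R2 y Y (R2 ∅ X (A4r ∅ y)))
    where
    instance≡ : sub y Y (sub ∅ X ((X′ & Y′) ⇒ Y′)) ≡ ((X & Y) ⇒ Y)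
    instance≡ rewrite eqObj-refl X | sub-fresh y Y X size-left = refl

  ax10 : ⊢ ((∅ ⇒ X) ⇒ ((∅ ⇒ Y) ⇒ (X & Y)))
  ax10 = subst ⊢_ instance≡ (R2 y Y (R2 ∅ X (A10 ∅ y)))
    where
    instance≡ : sub y Y (sub ∅ X ((∅ ⇒ X′) ⇒ ((∅ ⇒ Y′) ⇒ (X′ & Y′))))
                ≡ ((∅ ⇒ X) ⇒ ((∅ ⇒ Y) ⇒ (X & Y)))
    instance≡ rewrite eqObj-refl X | sub-fresh y Y X size-left = refl

  ax11 : ⊢ ((X ⇒ Y) ⇒ (∅ ⇒ (X ⇒ Y)))
  ax11 = subst ⊢_ instance≡ (R2 y Y (R2 ∅ X (A11 ∅ y)))
    where
    instance≡ : sub y Y (sub ∅ X ((X′ ⇒ Y′) ⇒ (∅ ⇒ (X′ ⇒ Y′))))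
                ≡ ((X ⇒ Y) ⇒ (∅ ⇒ (X ⇒ Y)))
    instance≡ rewrite eqObj-refl X | sub-fresh y Y X size-left = refl

module _ (C X Y : Obj) where
  private
    x = C & ∅
    y = C ⇒ X
    C′ = ∅ ᵛ
    X′ = x ᵛ
    Y′ = y ᵛ

  ax1 : ⊢ (((C ⇒ X) & (C ⇒ (X ⇒ Y))) ⇒ (C ⇒ Y))
  ax1 = subst ⊢_ instance≡ (R2 y Y (R2 x X (R2 ∅ C (A1 x y ∅))))
    where
    instance≡ : sub y Y (sub x X (sub ∅ C (((C′ ⇒ X′) & (C′ ⇒ (X′ ⇒ Y′))) ⇒ (C′ ⇒ Y′))))
                ≡ (((C ⇒ X) & (C ⇒ (X ⇒ Y))) ⇒ (C ⇒ Y))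
    instance≡ rewrite eqObj-refl C | eqObj-refl X | sub-fresh x X C size-left
                    | sub-fresh y Y C size-left | sub-fresh y Y X size-right = refl

  ax3 : ⊢ (((C ⇒ X) & (C ⇒ Y)) ⇒ (C ⇒ (X & Y)))
  ax3 = subst ⊢_ instance≡ (R2 y Y (R2 x X (R2 ∅ C (A3 x y ∅))))
    where
    instance≡ : sub y Y (sub x X (sub ∅ C (((C′ ⇒ X′) & (C′ ⇒ Y′)) ⇒ (C′ ⇒ (X′ & Y′)))))
                ≡ (((C ⇒ X) & (C ⇒ Y)) ⇒ (C ⇒ (X & Y)))
    instance≡ rewrite eqObj-refl C | eqObj-refl X | sub-fresh x X C size-left
                    | sub-fresh y Y C size-left | sub-fresh y Y X size-right = refl

module _ (D X Y Z : Obj) where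
  private
    x = D & ∅
    y = D ⇒ X
    z = D ∩ (X ∩ Y)
    D′ = ∅ ᵛ
    X′ = x ᵛ
    Y′ = y ᵛ
    Z′ = z ᵛ

  ax2 : ⊢ (((D ⇒ (X ⇒ Y)) & (D ⇒ (Y ⇒ Z))) ⇒ (D ⇒ (X ⇒ Z)))
  ax2 = subst ⊢_ instance≡ (R2 z Z (R2 y Y (R2 x X (R2 ∅ D (A2 x y z ∅)))))
    where
    instance≡ : sub z Z (sub y Y (sub x X (sub ∅ D
                  (((D′ ⇒ (X′ ⇒ Y′)) & (D′ ⇒ (Y′ ⇒ Z′))) ⇒ (D′ ⇒ (X′ ⇒ Z′))))))
                ≡ (((D ⇒ (X ⇒ Y)) & (D ⇒ (Y ⇒ Z))) ⇒ (D ⇒ (X ⇒ Z)))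
    instance≡ rewrite eqObj-refl D | eqObj-refl X | eqObj-refl Y
                    | sub-fresh x X D size-left | sub-fresh y Y D size-left
                    | sub-fresh y Y X size-right | sub-fresh z Z D size-left
                    | sub-fresh z Z X (≤-trans size-left size-right)
                    | sub-fresh z Z Y (≤-trans size-right size-right) = refl

bar-intro : ∀ {X Y} → ⊢ (X ⇒ Y) → ⊢ bar (X ⇒ Y)
bar-intro {X} {Y} h = R1 h (ax11 X Y)

&-intro : ∀ {A B C D} → ⊢ (A ⇒ B) → ⊢ (C ⇒ D) → ⊢ ((A ⇒ B) & (C ⇒ D))
&-intro {A} {B} {C} {D} h k = R1 (bar-intro k) (R1 (bar-intro h) (ax10 (A ⇒ B) (C ⇒ D)))

mp-under : ∀ {C X Y} → ⊢ (C ⇒ X) → ⊢ (C ⇒ (X ⇒ Y)) → ⊢ (C ⇒ Y)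
mp-under {C} {X} {Y} h k = R1 (&-intro h k) (ax1 C X Y)

&-under : ∀ {C X Y} → ⊢ (C ⇒ X) → ⊢ (C ⇒ Y) → ⊢ (C ⇒ (X & Y))
&-under {C} {X} {Y} h k = R1 (&-intro h k) (ax3 C X Y)

trans-under : ∀ {D X Y Z} → ⊢ (D ⇒ (X ⇒ Y)) → ⊢ (D ⇒ (Y ⇒ Z)) → ⊢ (D ⇒ (X ⇒ Z))
trans-under {D} {X} {Y} {Z} h k = R1 (&-intro h k) (ax2 D X Y Z)

-- bar X ⇒ X : from ∅ ⇒ X and the axiom bar X ⇒ ∅.
bar-elim : ∀ X → ⊢ (bar X ⇒ X)
bar-elim X = mp-under (ax8 (bar X)) (ax7 (bar X))

trans : ∀ {P Q R} → ⊢ (P ⇒ Q) → ⊢ (Q ⇒ R) → ⊢ (P ⇒ R)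
trans {P} {Q} {R} h k = R1 (trans-under (bar-intro h) (bar-intro k)) (bar-elim (P ⇒ R))

weaken : ∀ {C X Y} → ⊢ (X ⇒ Y) → ⊢ (C ⇒ (X ⇒ Y))
weaken {C} h = trans (ax8 C) (bar-intro h)

-- Federations of formulas; currying is available for these.
data ConjOfFormulas : Obj → Set where
  formula : ∀ X Y → ConjOfFormulas (X ⇒ Y)
  _&_     : ∀ {F G} → ConjOfFormulas F → ConjOfFormulas G → ConjOfFormulas (F & G)

necessitate : ∀ {F} → ConjOfFormulas F → ⊢ (F ⇒ bar F)
necessitate (formula X Y) = ax11 X Y
necessitate (_&_ {F} {G} p q) =
  trans (&-under (trans (ax4l F G) (necessitate p)) (trans (ax4r F G) (necessitate q))) (ax3 ∅ F G)

pair : ∀ {P Q} → ConjOfFormulas P → ConjOfFormulas Q → ⊢ (P ⇒ (Q ⇒ (P & Q)))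
pair {P} {Q} p q = trans-under (weaken (necessitate q)) (trans (necessitate p) (ax10 P Q))

curry : ∀ {P Q R} → ConjOfFormulas P → ConjOfFormulas Q → ⊢ ((P & Q) ⇒ R) → ⊢ (P ⇒ (Q ⇒ R))
curry {P} {Q} {R} p q h = trans-under (pair p q) (weaken h)

∈-conj : ∀ A C → ConjOfFormulas (A ∈ₒ C)
∈-conj A C = (formula _ _ & formula _ _) & formula C A

≐-conj : ∀ A C → ConjOfFormulas (A ≐ C)
≐-conj A C = formula A C & formula C A

nothing-belongs-to-empty : ∀ A C → ⊢ (((A ∈ₒ C) & (∅ ≐ C)) ⇒ ⊥ₒ)
nothing-belongs-to-empty A C = mp-under (&-under barA⇒A A⇒barA) notSelfBar
  where
  Nonself = bar A ≠ₒ A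
  Sing₂ = (A ⇒ bSing) ⇒ (bar bSing ∨ₒ (A ≐ bSing))
  M = (Nonself & Sing₂) & (C ⇒ A)
  Q = (∅ ⇒ C) & (C ⇒ ∅)
  H = M & Q

  notSelfBar : ⊢ (H ⇒ Nonself)
  notSelfBar = trans (ax4l M Q) (trans (ax4l (Nonself & Sing₂) (C ⇒ A)) (ax4l Nonself Sing₂))

  C-contains-A : ⊢ (H ⇒ (C ⇒ A))
  C-contains-A = trans (ax4l M Q) (ax4r (Nonself & Sing₂) (C ⇒ A))

  barC : ⊢ (H ⇒ bar C)
  barC = trans (ax4r M Q) (ax4l (∅ ⇒ C) (C ⇒ ∅))

  barA : ⊢ (H ⇒ bar A)
  barA = trans-under barC C-contains-A

  barA⇒A : ⊢ (H ⇒ (bar A ⇒ A))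
  barA⇒A = weaken (bar-elim A)

  A⇒barA : ⊢ (H ⇒ (A ⇒ bar A))
  A⇒barA = trans-under (weaken (ax8 A)) (trans barA (ax11 ∅ A))

theorem3p21 : (φ ξ a : Obj) → IsFormula φ →
    ⊢ (((a ᵛ) ∈ₒ cls ξ φ) ⇒ Ex ξ φ)
theorem3p21 φ ξ a _ =
  curry (∈-conj (a ᵛ) (cls ξ φ)) (≐-conj ∅ (cls ξ φ))
        (nothing-belongs-to-empty (a ᵛ) (cls ξ φ))
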